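{- Let $d\ge 1$ and $k\ge 1$ be integers. Let $G$ be a graph with a distance-$d$ fall coloring $f_G:V(G)\to\{1,\dots,k\}$, and let $H$ be a graph with a proper coloring $f_H:V(H)\to\{1,\dots,k\}$. Then the coloring of the cartesian product $G\Box H$ defined by $(g,h)\mapsto f_G(g)+f_H(h) \pmod k$ is a distance-$d$ fall $k$-coloring of $G\Box H$.
   Context: All graphs are finite and simple. A proper coloring assigns colors to vertices so that adjacent vertices receive different colors. A proper coloring with colors from $\{1,\dots,k\}$ is called distance-$d$ fall if every vertex is within (shortest-path) distance $d$ of at least one vertex of every one of the $k$ colors. The cartesian product $G\Box H$ has vertex set $V(G)\times V(H)$, with $(g,h)$ adjacent to $(g',h')$ iff either $g=g'$ and $hh'\in E(H)$, or $h=h'$ and $gg'\in E(G)$. -}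

module Defs where

open import Level using (Level; 0ℓ)
open import Data.Nat using (ℕ; zero; suc; _≤_; _+_; _*_; NonZero)
open import Data.Nat.DivMod using (_mod_)
open import Data.Fin using (Fin; toℕ; remQuot)
open import Data.Product using (Σ; ∃; _×_; _,_)
open import Data.Empty using (⊥)
open import Relation.Nullary using (¬_)
open import Relation.Binary.PropositionalEquality using (_≡_)

record Graph : Set₁ where
  field
    n     : ℕ
    Adj   : Fin n → Fin n → Set
    irrefl : ∀ {u} → ¬ Adj u u
    sym   : ∀ {u v} → Adj u v → Adj v u

open Graph public

V : Graph → Set
V G = Fin (n G)

data Walk (G : Graph) : V G → V G → ℕ → Set where
  here : ∀ {u} → Walk G u u zero
  step : ∀ {u v w m} → Adj G u v → Walk G v w m → Walk G u w (suc m)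

-- Shortest-path distance between u and v is at most d
-- (i.e. there is a u–v path, hence walk, of length ≤ d).
DistLe : (G : Graph) → V G → V G → ℕ → Set
DistLe G u v d = ∃ λ m → m ≤ d × Walk G u v m

-- Proper coloring with k colors (colors are Fin k, i.e. {0,…,k-1} ≅ {1,…,k}).
Proper : (G : Graph) (k : ℕ) → (V G → Fin k) → Set
Proper G k c = ∀ {u v} → Adj G u v → ¬ (c u ≡ c v)

IsDistFall : (d : ℕ) (G : Graph) (k : ℕ) → (V G → Fin k) → Set
IsDistFall d G k c =
  Proper G k c × (∀ (u : V G) (i : Fin k) → ∃ λ v → DistLe G u v d × c v ≡ i)

-- Cartesian product G □ H.  Vertex set V G × V H, encoded as Fin (n G * n H)
-- via the standard bijection  remQuot / combine  of Data.Fin.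
data ProdAdj (G H : Graph) : (V G × V H) → (V G × V H) → Set where
  inG : ∀ {g g' h} → Adj G g g' → ProdAdj G H (g , h) (g' , h)
  inH : ∀ {g h h'} → Adj H h h' → ProdAdj G H (g , h) (g , h')

private
  prodIrrefl : ∀ G H {x} → ¬ ProdAdj G H x x
  prodIrrefl G H (inG a) = irrefl G a
  prodIrrefl G H (inH a) = irrefl H a

  prodSym : ∀ G H {x y} → ProdAdj G H x y → ProdAdj G H y x
  prodSym G H (inG a) = inG (sym G a)
  prodSym G H (inH a) = inH (sym H a)

pair : (G H : Graph) → Fin (n G * n H) → V G × V H
pair G H x = remQuot (n H) x

_□_ : Graph → Graph → Graph
G □ H = record
  { n = n G * n H
  ; Adj = λ x y → ProdAdj G H (pair G H x) (pair G H y)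
  ; irrefl = prodIrrefl G H
  ; sym = prodSym G H
  }

sumColoring : (G H : Graph) (k : ℕ) .{{_ : NonZero k}} →
  (V G → Fin k) → (V H → Fin k) → V (G □ H) → Fin k
sumColoring G H k fG fH x with pair G H x
... | (g , h) = (toℕ (fG g) + toℕ (fH h)) mod k

-- Adding a fixed colour modulo k permutes the k colours.  Hence the colours of the
-- two ends of a G-edge inside an H-layer differ because those of fG do, and
-- symmetrically for H-edges.  To find colour i near (g , h), pick a vertex g' of
-- colour i − fH h within distance d of g in G; the walk from g to g' stays inside
-- the layer of h, and (g' , h) has colour (i − fH h) + fH h = i.
module Submission where

open import Defs hiding (sym)
open import Data.Nat using (ℕ; _+_; _∸_; _%_; _≥_; NonZero)
open import Data.Nat.Properties using (+-comm; +-assoc; m+[n∸m]≡n; m∸n+n≡m)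
open import Data.Nat.DivMod using (_mod_; %-distribˡ-+; m%n%n≡m%n; [m+n]%n≡m%n; m%n<n; m<n⇒m%n≡m)
open import Data.Fin using (Fin; toℕ; combine)
open import Data.Fin.Properties using (toℕ-fromℕ<; toℕ-injective; toℕ<n; toℕ≤n; remQuot-combine; combine-remQuot)
open import Data.Product using (∃; _×_; _,_; proj₁; proj₂; uncurry)
open import Function using (flip)
open import Relation.Nullary using (¬_)
open import Relation.Binary.PropositionalEquality
  using (_≡_; sym; trans; cong; subst; subst₂; module ≡-Reasoning)

module ModularAddition (k : ℕ) .{{_ : NonZero k}} where

  open ≡-Reasoning

  [m%k+n]%k≡[m+n]%k : ∀ m n → (m % k + n) % k ≡ (m + n) % k
  [m%k+n]%k≡[m+n]%k m n = begin
    (m % k + n) % k           ≡⟨ %-distribˡ-+ (m % k) n k ⟩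
    (m % k % k + n % k) % k   ≡⟨ cong (λ x → (x + n % k) % k) (m%n%n≡m%n m k) ⟩
    (m % k + n % k) % k       ≡⟨ %-distribˡ-+ m n k ⟨
    (m + n) % k               ∎

  [[m+n]%k+o]%k≡m%k : ∀ {m n o} → n + o ≡ k → ((m + n) % k + o) % k ≡ m % k
  [[m+n]%k+o]%k≡m%k {m} {n} {o} n+o≡k = begin
    ((m + n) % k + o) % k   ≡⟨ [m%k+n]%k≡[m+n]%k (m + n) o ⟩
    (m + n + o) % k         ≡⟨ cong (_% k) (+-assoc m n o) ⟩
    (m + (n + o)) % k       ≡⟨ cong (λ x → (m + x) % k) n+o≡k ⟩
    (m + k) % k             ≡⟨ [m+n]%n≡m%n m k ⟩
    m % k                   ∎

  toℕ-mod : ∀ m → toℕ (m mod k) ≡ m % k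
  toℕ-mod m = toℕ-fromℕ< (m%n<n m k)

  toℕ-mod-id : (a : Fin k) → toℕ a mod k ≡ a
  toℕ-mod-id a = toℕ-injective (trans (toℕ-mod (toℕ a)) (m<n⇒m%n≡m (toℕ<n a)))

  mod-+-mod : ∀ {m n o} → n + o ≡ k → (toℕ ((m + n) mod k) + o) mod k ≡ m mod k
  mod-+-mod {m} {n} {o} n+o≡k = toℕ-injective (begin
    toℕ ((toℕ ((m + n) mod k) + o) mod k)   ≡⟨ toℕ-mod _ ⟩
    (toℕ ((m + n) mod k) + o) % k           ≡⟨ cong (λ x → (x + o) % k) (toℕ-mod (m + n)) ⟩
    ((m + n) % k + o) % k                   ≡⟨ [[m+n]%k+o]%k≡m%k n+o≡k ⟩
    m % k                                   ≡⟨ toℕ-mod m ⟨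
    toℕ (m mod k)                           ∎)

  infixl 6 _⊕_ _⊖_

  _⊕_ : Fin k → Fin k → Fin k
  a ⊕ b = (toℕ a + toℕ b) mod k

  _⊖_ : Fin k → Fin k → Fin k
  a ⊖ b = (toℕ a + (k ∸ toℕ b)) mod k

  ⊕-comm : ∀ a b → a ⊕ b ≡ b ⊕ a
  ⊕-comm a b = cong (_mod k) (+-comm (toℕ a) (toℕ b))

  ⊕-⊖-cancel : ∀ a b → a ⊕ b ⊖ b ≡ a
  ⊕-⊖-cancel a b = trans (mod-+-mod (m+[n∸m]≡n (toℕ≤n b))) (toℕ-mod-id a)

  ⊖-⊕-cancel : ∀ a b → a ⊖ b ⊕ b ≡ a
  ⊖-⊕-cancel a b = trans (mod-+-mod (m∸n+n≡m (toℕ≤n b))) (toℕ-mod-id a)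

  ⊕-cancelʳ : ∀ {a b} c → a ⊕ c ≡ b ⊕ c → a ≡ b
  ⊕-cancelʳ {a} {b} c eq = begin
    a           ≡⟨ ⊕-⊖-cancel a c ⟨
    a ⊕ c ⊖ c   ≡⟨ cong (_⊖ c) eq ⟩
    b ⊕ c ⊖ c   ≡⟨ ⊕-⊖-cancel b c ⟩
    b           ∎

  ⊕-cancelˡ : ∀ {a b} c → c ⊕ a ≡ c ⊕ b → a ≡ b
  ⊕-cancelˡ {a} {b} c eq = ⊕-cancelʳ c (trans (⊕-comm a c) (trans eq (⊕-comm c b)))

module _ {G G′ : Graph} (φ : V G → V G′) (φ-adj : ∀ {u v} → Adj G u v → Adj G′ (φ u) (φ v)) where

  map-Walk : ∀ {u v m} → Walk G u v m → Walk G′ (φ u) (φ v) m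
  map-Walk here       = here
  map-Walk (step a w) = step (φ-adj a) (map-Walk w)

  map-DistLe : ∀ {u v d} → DistLe G u v d → DistLe G′ (φ u) (φ v) d
  map-DistLe (m , m≤d , w) = m , m≤d , map-Walk w

module _ (G H : Graph) where

  layer : V H → V G → V (G □ H)
  layer h g = combine g h

  layer-adj : ∀ h {u v} → Adj G u v → Adj (G □ H) (layer h u) (layer h v)
  layer-adj h {u} {v} a =
    subst₂ (ProdAdj G H) (sym (remQuot-combine u h)) (sym (remQuot-combine v h)) (inG a)

  layer-pair : ∀ {x g h} → pair G H x ≡ (g , h) → layer h g ≡ x
  layer-pair {x} x≡gh = trans (cong (uncurry (flip layer)) (sym x≡gh)) (combine-remQuot {n G} (n H) x)

module _ (G H : Graph) (k : ℕ) .{{_ : NonZero k}} (fG : V G → Fin k) (fH : V H → Fin k) where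

  open ModularAddition k

  sumColoring-layer : ∀ h g → sumColoring G H k fG fH (layer G H h g) ≡ fG g ⊕ fH h
  sumColoring-layer h g = cong (λ (g′ , h′) → fG g′ ⊕ fH h′) (remQuot-combine g h)

  sumColoring-proper : Proper G k fG → Proper H k fH → Proper (G □ H) k (sumColoring G H k fG fH)
  sumColoring-proper fG-proper fH-proper = properOnPairs
    where
    -- sumColoring G H k fG fH x unfolds to fG (proj₁ (pair G H x)) ⊕ fH (proj₂ (pair G H x)).
    properOnPairs : ∀ {p q} → ProdAdj G H p q →
      ¬ (fG (proj₁ p) ⊕ fH (proj₂ p) ≡ fG (proj₁ q) ⊕ fH (proj₂ q))
    properOnPairs (inG {h = h} a) eq = fG-proper a (⊕-cancelʳ (fH h) eq)
    properOnPairs (inH {g = g} a) eq = fH-proper a (⊕-cancelˡ (fG g) eq)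

  sumColoring-fall : ∀ {d} → IsDistFall d G k fG →
    ∀ (x : V (G □ H)) (i : Fin k) → ∃ λ y → DistLe (G □ H) x y d × sumColoring G H k fG fH y ≡ i
  sumColoring-fall (_ , fG-fall) x i
    with g , h ← pair G H x in x≡gh
    with g′ , g~g′ , fGg′≡i⊖fHh ← fG-fall g (i ⊖ fH h) =
    layer G H h g′ ,
    subst (λ z → DistLe (G □ H) z _ _) (layer-pair G H x≡gh) (map-DistLe (layer G H h) (layer-adj G H h) g~g′) ,
    (begin
      sumColoring G H k fG fH (layer G H h g′) ≡⟨ sumColoring-layer h g′ ⟩
      fG g′ ⊕ fH h                             ≡⟨ cong (_⊕ fH h) fGg′≡i⊖fHh ⟩
      i ⊖ fH h ⊕ fH h                          ≡⟨ ⊖-⊕-cancel i (fH h) ⟩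
      i                                        ∎)
    where open ≡-Reasoning

mainTheorem6 : (d k : ℕ) → d ≥ 1 → .{{_ : NonZero k}} →
    (G H : Graph) (fG : V G → Fin k) (fH : V H → Fin k) →
    IsDistFall d G k fG → Proper H k fH →
    IsDistFall d (G □ H) k (sumColoring G H k fG fH)
mainTheorem6 d k _ G H fG fH fG-fall fH-proper =
  sumColoring-proper G H k fG fH (proj₁ fG-fall) fH-proper ,
  sumColoring-fall G H k fG fH fG-fall
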